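{- Let $G=(V,E,\ell)$ be a weighted graph, $\Phi=(I,T,\mathcal{C})$ an interface of $G$, and $F$ a $\Phi$-tour in $G$. Let $W_0,\dots,W_p$ be a partition of $V$. For $i\in\{0,\dots,p\}$ let $\Phi_i=(I_i,T_i,\mathcal{C}_i)$ be the interface induced by $(F,\Phi)$ on $W_i$, and let $F_i$ be a $\Phi_i$-tour in $G[W_i]$. Then $F'=X\,\dot\cup\,\dot\bigcup_{i=0}^pF_i$ is a $\Phi$-tour in $G$, where $X=F\cap\bigcup_{i=0}^p\delta(W_i)$.
   Context: A weighted graph $G=(V,E,\ell)$ is an undirected graph without loops or parallel edges with $\ell:E\to\mathbb{R}_{\ge0}$. Multi-sets of edges are allowed, $\dot\cup$ denotes multi-union; $\mathrm{odd}(F)$ is the set of odd-degree vertices; $\delta(W)$ is the set of edges with exactly one endpoint in $W$; $F[W]$ is the multi-set of edges of $F$ with both endpoints in $W$, and $G[W]$ the induced subgraph. $G/I$ is $G$ with $I$ contracted ($G/\emptyset=G$). An interface of a graph $H=(U,E_H)$ is $\Phi=(I,T,\mathcal{C})$ with $T\subseteq I\subseteq U$, $|T|$ even, $\mathcal{C}$ a partition of $I$. A $\Phi$-tour in $H$ is a multi-set $F\subseteq E_H$ with $\mathrm{odd}(F)=T$, $(U,F)/I$ connected, each $C\in\mathcal{C}$ inside one connected component of $(U,F)$. The interface induced by $(F,\Phi)$ on $W\subseteq V$ is $(I_W,T_W,\mathcal{C}_W)$ where $I_W=(I\cap W)\cup U_W$ with $U_W$ the set of vertices in $W$ joined by an edge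 of $F$ to a vertex of $V\setminus W$; $T_W=\mathrm{odd}(F[W])$; and $\mathcal{C}_W$ contains, for each connected component of $(W,F[W])$, the set of vertices of $I_W$ in that component (nonempty sets only).
   Formalization: The edge weights ℓ take values in the nonnegative rationals rather than in ℝ≥0. -}

module Defs where

open import Data.Nat using (ℕ; zero; suc; _+_; _%_)
open import Data.Fin using (Fin; _≟_)
open import Data.Fin.Subset using (Subset; _∈_; _∉_; _⊆_; ∣_∣; ⊤)
open import Data.Fin.Subset.Properties using (_∈?_)
open import Data.Maybe using (Maybe; just; nothing)
open import Data.Bool using (Bool; true; false; if_then_else_; _xor_; _∧_)
open import Data.List using (List; []; _∷_; filter; map; concat; allFin; _++_)
open import Data.Bool.ListAction using (any)
open import Data.List.Membership.Propositional using () renaming (_∈_ to _∈ᴸ_)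
open import Data.Product using (Σ; ∃; _×_; _,_; proj₁; proj₂)
open import Data.Sum using (_⊎_)
open import Data.Empty using (⊥)
open import Data.Rational using (ℚ; 0ℚ) renaming (_≤_ to _≤ℚ_)
open import Relation.Nullary using (¬_; does; _×-dec_)
open import Relation.Binary.PropositionalEquality using (_≡_)

infix 2 _⟺_
_⟺_ : Set → Set → Set
A ⟺ B = (A → B) × (B → A)

-- A weighted graph on vertex set Fin n: undirected, no loops, no parallel
-- edges (Adj is a relation), with non-negative weights ℓ (ℓ is only
-- meaningful on edges).
record WGraph (n : ℕ) : Set₁ where
  field
    Adj      : Fin n → Fin n → Set
    Adj-sym  : ∀ {u v} → Adj u v → Adj v u
    Adj-irr  : ∀ {u} → ¬ Adj u u
    ℓ        : Fin n → Fin n → ℚ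
    ℓ-sym    : ∀ u v → ℓ u v ≡ ℓ v u
    ℓ-nonneg : ∀ u v → 0ℚ ≤ℚ ℓ u v
open WGraph public

-- An (unordered) edge is written as a pair of endpoints; a multi-set of
-- edges is a list of such pairs (order in the list is irrelevant for every
-- notion below); multi-union is list concatenation.
Edge : ℕ → Set
Edge n = Fin n × Fin n

EdgeMS : ℕ → Set
EdgeMS n = List (Edge n)

-- F is a multiset of edges of the graph H = G[U]  (G[⊤] = G)
EdgesOf : ∀ {n} → WGraph n → Subset n → EdgeMS n → Set
EdgesOf G U F = ∀ {e} → e ∈ᴸ F → Adj G (proj₁ e) (proj₂ e) × (proj₁ e ∈ U) × (proj₂ e ∈ U)

deg : ∀ {n} → EdgeMS n → Fin n → ℕ
deg [] v = 0
deg ((a , b) ∷ F) v =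
  (if does (a ≟ v) then 1 else 0) + (if does (b ≟ v) then 1 else 0) + deg F v

InOdd : ∀ {n} → EdgeMS n → Fin n → Set
InOdd F v = deg F v % 2 ≡ 1

data Reach {A : Set} (E : List (A × A)) : A → A → Set where
  here : ∀ {a} → Reach E a a
  fwd  : ∀ {a b c} → (a , b) ∈ᴸ E → Reach E b c → Reach E a c
  bwd  : ∀ {a b c} → (b , a) ∈ᴸ E → Reach E b c → Reach E a c

-- contraction map for G/I: all vertices of I become the single vertex
-- 'nothing'; other vertices x become 'just x'.  (If I = ∅ this is an
-- isomorphism, so G/∅ = G.)
κ : ∀ {n} → Subset n → Fin n → Maybe (Fin n)
κ I x = if does (x ∈? I) then nothing else just x

contractE : ∀ {n} → Subset n → EdgeMS n → List (Maybe (Fin n) × Maybe (Fin n))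
contractE I F = map (λ e → κ I (proj₁ e) , κ I (proj₂ e)) F

-- (U,F)/I is connected: any two vertices of the contracted graph (whose
-- vertex set is the image of U under κ) are joined by a walk.
ContractedConnected : ∀ {n} → Subset n → Subset n → EdgeMS n → Set
ContractedConnected U I F =
  ∀ u v → u ∈ U → v ∈ U → Reach (contractE I F) (κ I u) (κ I v)

IsPartition : ∀ {n} → Subset n → (k : ℕ) → (Fin k → Subset n) → Set
IsPartition {n} S k C =
    (∀ j → ∃ λ (x : Fin n) → x ∈ C j)
  × (∀ j j' (x : Fin n) → x ∈ C j → x ∈ C j' → j ≡ j')
  × (∀ j → C j ⊆ S)
  × (∀ x → x ∈ S → ∃ λ j → x ∈ C j)

record Interface (n : ℕ) : Set where
  constructor mkInterface
  field
    I : Subset n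
    T : Subset n
    k : ℕ
    C : Fin k → Subset n
open Interface public

IsInterfaceOf : ∀ {n} → Subset n → Interface n → Set
IsInterfaceOf U Φ =
  (T Φ ⊆ I Φ) × (I Φ ⊆ U) × (∣ T Φ ∣ % 2 ≡ 0) × IsPartition (I Φ) (k Φ) (C Φ)

IsTour : ∀ {n} → WGraph n → Subset n → Interface n → EdgeMS n → Set
IsTour G U Φ F =
    EdgesOf G U F
  × (∀ v → v ∈ T Φ ⟺ InOdd F v)
  × ContractedConnected U (I Φ) F
  × (∀ j x y → x ∈ C Φ j → y ∈ C Φ j → Reach F x y)

inducedMS : ∀ {n} → Subset n → EdgeMS n → EdgeMS n
inducedMS W F = filter (λ e → (proj₁ e ∈? W) ×-dec (proj₂ e ∈? W)) F

InBoundary : ∀ {n} → Subset n → EdgeMS n → Fin n → Set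
InBoundary W F x = (x ∈ W) × ∃ λ y → (y ∉ W) × (((x , y) ∈ᴸ F) ⊎ ((y , x) ∈ᴸ F))

IsCompBlock : ∀ {n} → EdgeMS n → Subset n → Subset n → Fin n → Subset n → Set
IsCompBlock F W IW w S =
  ∀ x → x ∈ S ⟺ ((x ∈ IW) × Reach (inducedMS W F) w x)

IsInducedInterface : ∀ {n} → EdgeMS n → Interface n → Subset n → Interface n → Set
IsInducedInterface {n} F Φ W Φ' =
    (∀ x → x ∈ I Φ' ⟺ (((x ∈ I Φ) × (x ∈ W)) ⊎ InBoundary W F x))
  × (∀ x → x ∈ T Φ' ⟺ InOdd (inducedMS W F) x)
  -- 𝒞_W is exactly the set of nonempty sets I_W ∩ K, K a component of (W, F[W])
  × (∀ j → (∃ λ x → x ∈ C Φ' j) × ∃ λ w → (w ∈ W) × IsCompBlock F W (I Φ') w (C Φ' j))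
  × (∀ w → w ∈ W → (∃ λ x → (x ∈ I Φ') × Reach (inducedMS W F) w x)
       → ∃ λ j → IsCompBlock F W (I Φ') w (C Φ' j))
  × (∀ j j' → C Φ' j ≡ C Φ' j' → j ≡ j')

-- X = F ∩ ⋃_i δ(W_i)  (all copies of edges of F crossing some W_i)
crossing : ∀ {n p} → (Fin (suc p) → Subset n) → EdgeMS n → EdgeMS n
crossing {p = p} W F =
  filter (λ e → T? (any (λ i → does (proj₁ e ∈? W i) xor does (proj₂ e ∈? W i)) (allFin (suc p)))) F
  where
    open import Data.Bool.Properties using (T?)

recombine : ∀ {n p} → (Fin (suc p) → Subset n) → EdgeMS n → (Fin (suc p) → EdgeMS n) → EdgeMS n
recombine {p = p} W F Fs = crossing W F ++ concat (map Fs (allFin (suc p)))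

module Submission where

-- Parity: for v ∈ Wᵢ the degrees of v in F and F′ are deg_X v + deg_F[Wᵢ] v and
-- deg_X v + deg_Fᵢ v, and F[Wᵢ], Fᵢ have the same odd vertices Tᵢ.
-- Connectivity: an edge of F inside Wᵢ is replaced by a walk of Fᵢ in G[Wᵢ]/Iᵢ, so it
-- suffices that F′/I connects all of Iᵢ. Along a walk of F/I starting in Iᵢ, keep an
-- interface vertex of the current component of F[Wⱼ] that is already joined to the start:
-- when the walk leaves Wⱼ along an edge of X, its exit vertex is in Iⱼ and in the same
-- component of F[Wⱼ], hence in the same block of 𝒞ⱼ, so Fⱼ joins it to the kept vertex.
-- The blocks of 𝒞 are connected in F′ by the same argument without contraction.

open import Defs
open import Data.Nat using (ℕ; zero; suc; _+_; _%_; s≤s)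
open import Data.Nat.Properties using (+-assoc; +-comm; +-identityʳ)
open import Data.Nat.DivMod using (%-distribˡ-+; m%n<n)
open import Data.Fin using (Fin; zero; suc; _≟_)
open import Data.Fin.Properties using (suc-injective)
open import Data.Fin.Subset using (Subset; ⊤; _∈_; _∉_)
open import Data.Fin.Subset.Properties using (_∈?_; ∈⊤)
open import Data.Maybe using (nothing)
open import Data.Bool using (_xor_; if_then_else_) renaming (T to IsTrue)
open import Data.Bool.Properties using (T?)
open import Data.Bool.ListAction using (any)
open import Data.List using (List; []; _∷_; _++_; map; concat; filter; allFin; tabulate)
open import Data.List.Properties using (map-tabulate)
open import Data.List.Membership.Propositional using (lose) renaming (_∈_ to _∈ᴸ_)
open import Data.List.Membership.Propositional.Properties
  using ( ∈-map⁺; ∈-map⁻; ∈-++⁺ˡ; ∈-++⁺ʳ; ∈-++⁻; ∈-concat⁺′; ∈-concat⁻′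
        ; ∈-filter⁺; ∈-filter⁻; ∈-allFin)
open import Data.List.Relation.Unary.Any using (here; there; satisfied)
open import Data.List.Relation.Unary.Any.Properties using (any⁺; any⁻)
open import Data.Product using (∃; _×_; _,_; proj₁; proj₂)
open import Data.Sum using (_⊎_; inj₁; inj₂; swap)
open import Data.Unit using (tt)
open import Function using (id; _∘_)
open import Relation.Nullary using (¬_; yes; no; does; _×-dec_)
open import Relation.Nullary.Decidable using (dec-true; dec-false)
open import Relation.Unary using (Decidable)
open import Relation.Binary.Structures using (IsEquivalence)
open import Relation.Binary.PropositionalEquality
  using (_≡_; _≢_; refl; sym; trans; cong; cong₂; subst₂; module ≡-Reasoning)

module _ {A : Set} {E : List (A × A)} where

  Reach-trans : ∀ {a b c} → Reach E a b → Reach E b c → Reach E a c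
  Reach-trans here q = q
  Reach-trans (fwd e r) q = fwd e (Reach-trans r q)
  Reach-trans (bwd e r) q = bwd e (Reach-trans r q)

  Reach-sym : ∀ {a b} → Reach E a b → Reach E b a
  Reach-sym here = here
  Reach-sym (fwd e r) = Reach-trans (Reach-sym r) (bwd e here)
  Reach-sym (bwd e r) = Reach-trans (Reach-sym r) (fwd e here)

  Reach-isEquivalence : IsEquivalence (Reach E)
  Reach-isEquivalence = record { refl = here ; sym = Reach-sym ; trans = Reach-trans }

  Reach⇒ : ∀ {_∼_ : A → A → Set} → IsEquivalence _∼_
         → (∀ {a b} → (a , b) ∈ᴸ E → a ∼ b) → ∀ {a b} → Reach E a b → a ∼ b
  Reach⇒ ∼-equiv edge here = IsEquivalence.refl ∼-equiv
  Reach⇒ ∼-equiv edge (fwd e r) = IsEquivalence.trans ∼-equiv (edge e) (Reach⇒ ∼-equiv edge r)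
  Reach⇒ ∼-equiv edge (bwd e r) =
    IsEquivalence.trans ∼-equiv (IsEquivalence.sym ∼-equiv (edge e)) (Reach⇒ ∼-equiv edge r)

on-isEquivalence : ∀ {A B : Set} {_∼_ : B → B → Set} (f : A → B)
                 → IsEquivalence _∼_ → IsEquivalence (λ a a′ → f a ∼ f a′)
on-isEquivalence f ∼-equiv = record
  { refl = IsEquivalence.refl ∼-equiv
  ; sym = IsEquivalence.sym ∼-equiv
  ; trans = IsEquivalence.trans ∼-equiv
  }

⟺-on-isEquivalence : ∀ {A : Set} (Q : A → Set) → IsEquivalence (λ a b → Q a ⟺ Q b)
⟺-on-isEquivalence Q = record
  { refl = id , id
  ; sym = swap⟺
  ; trans = λ (f , g) (f′ , g′) → f′ ∘ f , g ∘ g′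
  }
  where
    swap⟺ : ∀ {X Y : Set} → X ⟺ Y → Y ⟺ X
    swap⟺ (f , g) = g , f

Reach-mono : ∀ {A : Set} {E E′ : List (A × A)} → (∀ {e} → e ∈ᴸ E → e ∈ᴸ E′)
           → ∀ {a b} → Reach E a b → Reach E′ a b
Reach-mono E⊆E′ = Reach⇒ Reach-isEquivalence (λ e → fwd (E⊆E′ e) here)

Reach-map : ∀ {A B : Set} {E : List (A × A)} (f : A → B) {a b}
          → Reach E a b → Reach (map (λ e → f (proj₁ e) , f (proj₂ e)) E) (f a) (f b)
Reach-map f = Reach⇒ (on-isEquivalence f Reach-isEquivalence) (λ e → fwd (∈-map⁺ _ e) here)

module _ {n : ℕ} where

  ContractedReach : Subset n → EdgeMS n → Fin n → Fin n → Set
  ContractedReach J E a b = Reach (contractE J E) (κ J a) (κ J b)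

  ContractedReach-isEquivalence : ∀ (J : Subset n) E → IsEquivalence (ContractedReach J E)
  ContractedReach-isEquivalence J E = on-isEquivalence (κ J) Reach-isEquivalence

  Reach⇒ContractedReach : ∀ {J : Subset n} {E a b} → Reach E a b → ContractedReach J E a b
  Reach⇒ContractedReach {J} = Reach-map (κ J)

  κ-∈ : ∀ {J : Subset n} {x} → x ∈ J → κ J x ≡ nothing
  κ-∈ {J} {x} x∈J rewrite dec-true (x ∈? J) x∈J = refl

  ContractedReach-∈ : ∀ {J : Subset n} {E a b} → a ∈ J → b ∈ J → ContractedReach J E a b
  ContractedReach-∈ a∈J b∈J = subst₂ (Reach _) (sym (κ-∈ a∈J)) (sym (κ-∈ b∈J)) here

  κ-identifies : ∀ (J : Subset n) a b → κ J a ≡ κ J b → a ≡ b ⊎ (a ∈ J × b ∈ J)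
  κ-identifies J a b κa≡κb with a ∈? J | b ∈? J
  ... | yes a∈J | yes b∈J = inj₂ (a∈J , b∈J)
  ... | yes _ | no _ with () ← κa≡κb
  ... | no _ | yes _ with () ← κa≡κb
  ... | no _ | no _ with refl ← κa≡κb = inj₁ refl

  ContractedReach⇒ : ∀ {J : Subset n} {E} {_∼_ : Fin n → Fin n → Set} → IsEquivalence _∼_
                   → (∀ {a b} → (a , b) ∈ᴸ E → a ∼ b) → (∀ {a b} → a ∈ J → b ∈ J → a ∼ b)
                   → ∀ {a b} → ContractedReach J E a b → a ∼ b
  ContractedReach⇒ {J} {E} {_∼_} ∼-equiv edge glue r = lift r _ _ refl refl
    where
      open IsEquivalence ∼-equiv renaming (refl to ∼-refl; sym to ∼-sym; trans to ∼-trans)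

      same-image : ∀ {a b} → κ J a ≡ κ J b → a ∼ b
      same-image {a} {b} eq with κ-identifies J a b eq
      ... | inj₁ refl = ∼-refl
      ... | inj₂ (a∈J , b∈J) = glue a∈J b∈J

      lift : ∀ {z z′} → Reach (contractE J E) z z′ → ∀ a b → κ J a ≡ z → κ J b ≡ z′ → a ∼ b
      lift here a b κa κb = same-image (trans κa (sym κb))
      lift (fwd e r) a b κa κb with ∈-map⁻ _ e
      ... | (c , d) , cd∈E , refl = ∼-trans (same-image κa) (∼-trans (edge cd∈E) (lift r d b refl κb))
      lift (bwd e r) a b κa κb with ∈-map⁻ _ e
      ... | (d , c) , dc∈E , refl =
        ∼-trans (same-image κa) (∼-trans (∼-sym (edge dc∈E)) (lift r d b refl κb))

module _ {n : ℕ} where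

  Incident : Fin n → Edge n → Set
  Incident v e = proj₁ e ≡ v ⊎ proj₂ e ≡ v

  edgeDeg : Edge n → Fin n → ℕ
  edgeDeg (a , b) v = (if does (a ≟ v) then 1 else 0) + (if does (b ≟ v) then 1 else 0)

  edgeDeg-nonincident : ∀ {v} e → ¬ Incident v e → edgeDeg e v ≡ 0
  edgeDeg-nonincident {v} (a , b) ¬inc
    rewrite dec-false (a ≟ v) (¬inc ∘ inj₁) | dec-false (b ≟ v) (¬inc ∘ inj₂) = refl

  deg-++ : ∀ (L M : EdgeMS n) v → deg (L ++ M) v ≡ deg L v + deg M v
  deg-++ [] M v = refl
  deg-++ (e ∷ L) M v = trans (cong (edgeDeg e v +_) (deg-++ L M v)) (sym (+-assoc (edgeDeg e v) _ _))

  deg-nonincident : ∀ {v} (L : EdgeMS n) → (∀ {e} → e ∈ᴸ L → ¬ Incident v e) → deg L v ≡ 0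
  deg-nonincident [] _ = refl
  deg-nonincident {v} (e ∷ L) ¬inc =
    cong₂ _+_ (edgeDeg-nonincident e (¬inc (here refl))) (deg-nonincident L (¬inc ∘ there))

  deg-filter-split : ∀ {P Q : Edge n → Set} (P? : Decidable P) (Q? : Decidable Q) {v}
                   → (∀ e → Incident v e → P e ⟺ ¬ Q e)
                   → ∀ L → deg (filter P? L) v + deg (filter Q? L) v ≡ deg L v
  deg-filter-split P? Q? split [] = refl
  deg-filter-split P? Q? {v} split (e ∷ L) with P? e | Q? e | deg-filter-split P? Q? split L
  ... | yes _ | no _ | ih = trans (+-assoc (edgeDeg e v) _ _) (cong (edgeDeg e v +_) ih)
  ... | no _ | yes _ | ih = begin
    dP + (c + dQ) ≡⟨ sym (+-assoc dP c dQ) ⟩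
    dP + c + dQ   ≡⟨ cong (_+ dQ) (+-comm dP c) ⟩
    c + dP + dQ   ≡⟨ +-assoc c dP dQ ⟩
    c + (dP + dQ) ≡⟨ cong (c +_) ih ⟩
    c + deg L v   ∎
    where
      open ≡-Reasoning
      c = edgeDeg e v
      dP = deg (filter P? L) v
      dQ = deg (filter Q? L) v
  ... | yes Pe | yes Qe | ih
    rewrite edgeDeg-nonincident e (λ inc → proj₁ (split e inc) Pe Qe) = ih
  ... | no ¬Pe | no ¬Qe | ih
    rewrite edgeDeg-nonincident e (λ inc → ¬Pe (proj₂ (split e inc) ¬Qe)) = ih

  deg-concat-tabulate-zero : ∀ {m} (Es : Fin m → EdgeMS n) {v} → (∀ k → deg (Es k) v ≡ 0)
                           → deg (concat (tabulate Es)) v ≡ 0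
  deg-concat-tabulate-zero {zero} Es zeros = refl
  deg-concat-tabulate-zero {suc m} Es {v} zeros =
    trans (deg-++ (Es zero) _ v)
          (cong₂ _+_ (zeros zero) (deg-concat-tabulate-zero (Es ∘ suc) (zeros ∘ suc)))

  deg-concat-tabulate : ∀ {m} (Es : Fin m → EdgeMS n) i {v} → (∀ k → k ≢ i → deg (Es k) v ≡ 0)
                      → deg (concat (tabulate Es)) v ≡ deg (Es i) v
  deg-concat-tabulate Es zero {v} others = begin
    deg (Es zero ++ concat (tabulate (Es ∘ suc))) v        ≡⟨ deg-++ (Es zero) _ v ⟩
    deg (Es zero) v + deg (concat (tabulate (Es ∘ suc))) v ≡⟨ cong (deg (Es zero) v +_) rest ⟩
    deg (Es zero) v + 0                                    ≡⟨ +-identityʳ _ ⟩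
    deg (Es zero) v                                        ∎
    where
      open ≡-Reasoning
      rest = deg-concat-tabulate-zero (Es ∘ suc) (λ k → others (suc k) λ ())
  deg-concat-tabulate Es (suc i) {v} others = begin
    deg (Es zero ++ concat (tabulate (Es ∘ suc))) v        ≡⟨ deg-++ (Es zero) _ v ⟩
    deg (Es zero) v + deg (concat (tabulate (Es ∘ suc))) v ≡⟨ cong₂ _+_ (others zero λ ()) rest ⟩
    0 + deg (Es (suc i)) v                                 ∎
    where
      open ≡-Reasoning
      rest = deg-concat-tabulate (Es ∘ suc) i (λ k k≢i → others (suc k) (k≢i ∘ suc-injective))

%2-≡ : ∀ m n → (m % 2 ≡ 1 ⟺ n % 2 ≡ 1) → m % 2 ≡ n % 2
%2-≡ m n (m-odd⇒ , n-odd⇒) with m % 2 | n % 2 | m%n<n m 2 | m%n<n n 2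
... | 0 | 0 | _ | _ = refl
... | 1 | 1 | _ | _ = refl
... | 0 | 1 | _ | _ with () ← n-odd⇒ refl
... | 1 | 0 | _ | _ with () ← m-odd⇒ refl
... | suc (suc _) | _ | s≤s (s≤s ()) | _
... | _ | suc (suc _) | _ | s≤s (s≤s ())

+-%2-congˡ : ∀ m {n o : ℕ} → n % 2 ≡ o % 2 → (m + n) % 2 ≡ (m + o) % 2
+-%2-congˡ m {n} {o} n≡o = begin
  (m + n) % 2           ≡⟨ %-distribˡ-+ m n 2 ⟩
  (m % 2 + n % 2) % 2   ≡⟨ cong (λ r → (m % 2 + r) % 2) n≡o ⟩
  (m % 2 + o % 2) % 2   ≡⟨ %-distribˡ-+ m o 2 ⟨
  (m + o) % 2           ∎
  where open ≡-Reasoning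

module _ {n : ℕ} {S : Subset n} {a b : Fin n} where

  xor-∈∉ : a ∈ S → b ∉ S → IsTrue (does (a ∈? S) xor does (b ∈? S))
  xor-∈∉ a∈S b∉S rewrite dec-true (a ∈? S) a∈S | dec-false (b ∈? S) b∉S = tt

  xor-∉∈ : a ∉ S → b ∈ S → IsTrue (does (a ∈? S) xor does (b ∈? S))
  xor-∉∈ a∉S b∈S rewrite dec-false (a ∈? S) a∉S | dec-true (b ∈? S) b∈S = tt

module _ {n p : ℕ} (W : Fin (suc p) → Subset n) where

  Crosses : Edge n → Set
  Crosses e = IsTrue (any (λ i → does (proj₁ e ∈? W i) xor does (proj₂ e ∈? W i)) (allFin (suc p)))

  crosses? : Decidable Crosses
  crosses? e = T? _

  crosses-∈∉ : ∀ i {a b} → a ∈ W i → b ∉ W i → Crosses (a , b)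
  crosses-∈∉ i a∈ b∉ = any⁺ _ (lose (∈-allFin i) (xor-∈∉ a∈ b∉))

  crosses-∉∈ : ∀ i {a b} → a ∉ W i → b ∈ W i → Crosses (a , b)
  crosses-∉∈ i a∉ b∈ = any⁺ _ (lose (∈-allFin i) (xor-∉∈ a∉ b∈))

  inside-¬crosses : (∀ j j′ x → x ∈ W j → x ∈ W j′ → j ≡ j′)
                  → ∀ i {a b} → a ∈ W i → b ∈ W i → ¬ Crosses (a , b)
  inside-¬crosses disjoint i {a} {b} a∈ b∈ crosses
    with k , xor-k ← satisfied (any⁻ _ (allFin (suc p)) crosses)
    with a ∈? W k | b ∈? W k | xor-k
  ... | yes a∈k | no b∉k | _ rewrite disjoint k i a a∈k a∈ = b∉k b∈
  ... | no a∉k | yes b∈k | _ rewrite disjoint k i b b∈k b∈ = a∉k a∈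

module Recombination {n} (G : WGraph n) (Φ : Interface n) (F : EdgeMS n)
  (Φ-interface : IsInterfaceOf ⊤ Φ) (F-tour : IsTour G ⊤ Φ F)
  {p : ℕ} (W : Fin (suc p) → Subset n) (W-partition : IsPartition ⊤ (suc p) W)
  (Φs : Fin (suc p) → Interface n) (Φs-induced : ∀ i → IsInducedInterface F Φ (W i) (Φs i))
  (Fs : Fin (suc p) → EdgeMS n) (Fs-tour : ∀ i → IsTour G (W i) (Φs i) (Fs i)) where

  F′ : EdgeMS n
  F′ = recombine W F Fs

  F-connected : ContractedConnected ⊤ (I Φ) F
  F-connected = proj₁ (proj₂ (proj₂ F-tour))

  Fᵢ-inside : ∀ i {e} → e ∈ᴸ Fs i → proj₁ e ∈ W i × proj₂ e ∈ W i
  Fᵢ-inside i e∈Fᵢ = proj₂ (proj₁ (Fs-tour i) e∈Fᵢ)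

  W-disjoint : ∀ j j′ x → x ∈ W j → x ∈ W j′ → j ≡ j′
  W-disjoint = proj₁ (proj₂ W-partition)

  W-cover : ∀ x → ∃ λ i → x ∈ W i
  W-cover x = proj₂ (proj₂ (proj₂ W-partition)) x ∈⊤

  Iᵢ⊆Wᵢ : ∀ {i x} → x ∈ I (Φs i) → x ∈ W i
  Iᵢ⊆Wᵢ {i} {x} x∈Iᵢ with proj₁ (proj₁ (Φs-induced i) x) x∈Iᵢ
  ... | inj₁ (_ , x∈W) = x∈W
  ... | inj₂ (x∈W , _) = x∈W

  I∩Wᵢ⊆Iᵢ : ∀ {i x} → x ∈ I Φ → x ∈ W i → x ∈ I (Φs i)
  I∩Wᵢ⊆Iᵢ {i} {x} x∈I x∈W = proj₂ (proj₁ (Φs-induced i) x) (inj₁ (x∈I , x∈W))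

  boundary⊆Iᵢ : ∀ {i x y} → x ∈ W i → y ∉ W i → (x , y) ∈ᴸ F ⊎ (y , x) ∈ᴸ F → x ∈ I (Φs i)
  boundary⊆Iᵢ {i} {x} {y} x∈W y∉W xy = proj₂ (proj₁ (Φs-induced i) x) (inj₂ (x∈W , y , y∉W , xy))

  -- Interface vertices in one component of F[Wᵢ] form a block of 𝒞ᵢ, which Fᵢ must keep connected.
  Fᵢ-joins-components : ∀ {i q c} → q ∈ I (Φs i) → c ∈ I (Φs i)
                      → Reach (inducedMS (W i) F) q c → Reach (Fs i) q c
  Fᵢ-joins-components {i} {q} {c} q∈Iᵢ c∈Iᵢ q⇝c
    with j , block ← proj₁ (proj₂ (proj₂ (proj₂ (Φs-induced i)))) q (Iᵢ⊆Wᵢ q∈Iᵢ) (q , q∈Iᵢ , here)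
    = Fᵢ-blocks j q c (proj₂ (block q) (q∈Iᵢ , here)) (proj₂ (block c) (c∈Iᵢ , q⇝c))
    where Fᵢ-blocks = proj₂ (proj₂ (proj₂ (Fs-tour i)))

  Fᵢ⊆F′ : ∀ {i e} → e ∈ᴸ Fs i → e ∈ᴸ F′
  Fᵢ⊆F′ {i} e∈Fᵢ = ∈-++⁺ʳ (crossing W F) (∈-concat⁺′ e∈Fᵢ (∈-map⁺ Fs (∈-allFin i)))

  crossing⊆F′ : ∀ {e} → e ∈ᴸ F → Crosses W e → e ∈ᴸ F′
  crossing⊆F′ e∈F crosses = ∈-++⁺ˡ (∈-filter⁺ (crosses? W) e∈F crosses)

  module Anchoring (P : Fin n → Set) (P-closed : ∀ {a b} → P a → Reach F′ a b → P b) where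

    Anchored : Fin n → Set
    Anchored c = ∃ λ i → c ∈ W i × ∃ λ q → q ∈ I (Φs i) × P q × Reach (inducedMS (W i) F) q c

    anchored : ∀ {i x} → x ∈ I (Φs i) → P x → Anchored x
    anchored {i} x∈Iᵢ Px = i , Iᵢ⊆Wᵢ x∈Iᵢ , _ , x∈Iᵢ , Px , here

    anchored-interface : ∀ {i c} → Anchored c → c ∈ I (Φs i) → P c
    anchored-interface {i} {c} (i′ , c∈W′ , q , q∈Iᵢ′ , Pq , q⇝c) c∈Iᵢ
      with refl ← W-disjoint i i′ c (Iᵢ⊆Wᵢ c∈Iᵢ) c∈W′
      = P-closed Pq (Reach-mono Fᵢ⊆F′ (Fᵢ-joins-components q∈Iᵢ′ c∈Iᵢ q⇝c))

    anchored-step : ∀ {c d} → (c , d) ∈ᴸ F ⊎ (d , c) ∈ᴸ F → Anchored c → Anchored d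
    anchored-step {c} {d} cd a@(i , c∈W , q , q∈Iᵢ , Pq , q⇝c) with W-cover d
    ... | j , d∈Wj with i ≟ j
    ... | yes refl = i , d∈Wj , q , q∈Iᵢ , Pq , Reach-trans q⇝c (edge-inside cd)
      where
        edge-inside : (c , d) ∈ᴸ F ⊎ (d , c) ∈ᴸ F → Reach (inducedMS (W i) F) c d
        edge-inside (inj₁ cd∈F) = fwd (∈-filter⁺ _ cd∈F (c∈W , d∈Wj)) here
        edge-inside (inj₂ dc∈F) = bwd (∈-filter⁺ _ dc∈F (d∈Wj , c∈W)) here
    ... | no i≢j = anchored d∈Iⱼ (P-closed (anchored-interface a c∈Iᵢ) (edge-crossing cd))
      where
        d∉Wᵢ : d ∉ W i
        d∉Wᵢ d∈Wᵢ = i≢j (W-disjoint i j d d∈Wᵢ d∈Wj)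
        c∉Wⱼ : c ∉ W j
        c∉Wⱼ c∈Wⱼ = i≢j (W-disjoint i j c c∈W c∈Wⱼ)
        c∈Iᵢ = boundary⊆Iᵢ c∈W d∉Wᵢ cd
        d∈Iⱼ = boundary⊆Iᵢ d∈Wj c∉Wⱼ (swap cd)
        edge-crossing : (c , d) ∈ᴸ F ⊎ (d , c) ∈ᴸ F → Reach F′ c d
        edge-crossing (inj₁ cd∈F) = fwd (crossing⊆F′ cd∈F (crosses-∈∉ W i c∈W d∉Wᵢ)) here
        edge-crossing (inj₂ dc∈F) = bwd (crossing⊆F′ dc∈F (crosses-∉∈ W i d∉Wᵢ c∈W)) here

    anchored-edge : ∀ {c d} → (c , d) ∈ᴸ F → Anchored c ⟺ Anchored d
    anchored-edge cd∈F = anchored-step (inj₁ cd∈F) , anchored-step (inj₂ cd∈F)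

    anchored-glue : (∀ {a b} → a ∈ I Φ → b ∈ I Φ → P a → P b)
                  → ∀ {a b} → a ∈ I Φ → b ∈ I Φ → Anchored a ⟺ Anchored b
    anchored-glue P-glued a∈I b∈I = move a∈I b∈I , move b∈I a∈I
      where
        move : ∀ {a b} → a ∈ I Φ → b ∈ I Φ → Anchored a → Anchored b
        move {a} {b} a∈I b∈I anc@(i , a∈Wᵢ , _) with j , b∈Wⱼ ← W-cover b =
          anchored (I∩Wᵢ⊆Iᵢ b∈I b∈Wⱼ) (P-glued a∈I b∈I (anchored-interface anc (I∩Wᵢ⊆Iᵢ a∈I a∈Wᵢ)))

  F′-edges : EdgesOf G ⊤ F′
  F′-edges e∈F′ with ∈-++⁻ (crossing W F) e∈F′
  ... | inj₁ e∈X = proj₁ (proj₁ F-tour (proj₁ (∈-filter⁻ (crosses? W) e∈X))) , ∈⊤ , ∈⊤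
  ... | inj₂ e∈⋃Fᵢ
    with Eᵢ , e∈Eᵢ , Eᵢ∈Fs ← ∈-concat⁻′ (map Fs (allFin (suc p))) e∈⋃Fᵢ
    with i , _ , refl ← ∈-map⁻ Fs Eᵢ∈Fs
    = proj₁ (proj₁ (Fs-tour i) e∈Eᵢ) , ∈⊤ , ∈⊤

  module _ {i v} (v∈Wᵢ : v ∈ W i) where

    deg-F : deg (crossing W F) v + deg (inducedMS (W i) F) v ≡ deg F v
    deg-F = deg-filter-split (crosses? W) (λ e → (proj₁ e ∈? W i) ×-dec (proj₂ e ∈? W i)) split F
      where
        split : ∀ e → Incident v e → Crosses W e ⟺ ¬ (proj₁ e ∈ W i × proj₂ e ∈ W i)
        split (a , b) (inj₁ refl) =
          (λ crosses (_ , b∈) → inside-¬crosses W W-disjoint i v∈Wᵢ b∈ crosses) ,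
          (λ ¬inside → crosses-∈∉ W i v∈Wᵢ (λ b∈ → ¬inside (v∈Wᵢ , b∈)))
        split (a , b) (inj₂ refl) =
          (λ crosses (a∈ , _) → inside-¬crosses W W-disjoint i a∈ v∈Wᵢ crosses) ,
          (λ ¬inside → crosses-∉∈ W i (λ a∈ → ¬inside (a∈ , v∈Wᵢ)) v∈Wᵢ)

    deg-F′ : deg F′ v ≡ deg (crossing W F) v + deg (Fs i) v
    deg-F′ = begin
      deg F′ v
        ≡⟨ deg-++ (crossing W F) _ v ⟩
      dX + deg (concat (map Fs (allFin (suc p)))) v
        ≡⟨ cong (λ L → dX + deg (concat L) v) (map-tabulate id Fs) ⟩
      dX + deg (concat (tabulate Fs)) v
        ≡⟨ cong (dX +_) (deg-concat-tabulate Fs i others) ⟩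
      dX + deg (Fs i) v
        ∎
      where
        open ≡-Reasoning
        dX = deg (crossing W F) v
        others : ∀ k → k ≢ i → deg (Fs k) v ≡ 0
        others k k≢i = deg-nonincident (Fs k) λ e∈Fₖ → λ
          { (inj₁ refl) → k≢i (W-disjoint k i v (proj₁ (Fᵢ-inside k e∈Fₖ)) v∈Wᵢ)
          ; (inj₂ refl) → k≢i (W-disjoint k i v (proj₂ (Fᵢ-inside k e∈Fₖ)) v∈Wᵢ) }

    deg-F′-%2 : deg F′ v % 2 ≡ deg F v % 2
    deg-F′-%2 = begin
      deg F′ v % 2                               ≡⟨ cong (_% 2) deg-F′ ⟩
      (dX + deg (Fs i) v) % 2                    ≡⟨ +-%2-congˡ dX Fᵢ≡F[Wᵢ] ⟩
      (dX + deg (inducedMS (W i) F) v) % 2       ≡⟨ cong (_% 2) deg-F ⟩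
      deg F v % 2                                ∎
      where
        open ≡-Reasoning
        dX = deg (crossing W F) v
        F[Wᵢ]-odd = proj₁ (proj₂ (Φs-induced i)) v
        Fᵢ-odd = proj₁ (proj₂ (Fs-tour i)) v
        Fᵢ≡F[Wᵢ] : deg (Fs i) v % 2 ≡ deg (inducedMS (W i) F) v % 2
        Fᵢ≡F[Wᵢ] = %2-≡ (deg (Fs i) v) (deg (inducedMS (W i) F) v)
                         (proj₁ F[Wᵢ]-odd ∘ proj₂ Fᵢ-odd , proj₁ Fᵢ-odd ∘ proj₂ F[Wᵢ]-odd)

  F′-odd : ∀ v → v ∈ T Φ ⟺ InOdd F′ v
  F′-odd v with i , v∈Wᵢ ← W-cover v =
    (λ v∈T → trans (deg-F′-%2 v∈Wᵢ) (proj₁ F-odd v∈T)) ,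
    (λ odd → proj₂ F-odd (trans (sym (deg-F′-%2 v∈Wᵢ)) odd))
    where F-odd = proj₁ (proj₂ F-tour) v

  F′-blocks : ∀ j x y → x ∈ C Φ j → y ∈ C Φ j → Reach F′ x y
  F′-blocks j x y x∈Cⱼ y∈Cⱼ
    with i , x∈Wᵢ ← W-cover x | i′ , y∈Wᵢ′ ← W-cover y =
    anchored-interface y-anchored (I∩Wᵢ⊆Iᵢ (Cⱼ⊆I y∈Cⱼ) y∈Wᵢ′)
    where
      open Anchoring (Reach F′ x) Reach-trans
      Cⱼ⊆I = proj₁ (proj₂ (proj₂ (proj₂ (proj₂ (proj₂ Φ-interface))))) j
      y-anchored : Anchored y
      y-anchored = proj₁ (Reach⇒ (⟺-on-isEquivalence Anchored) anchored-edge F-walk)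
                         (anchored (I∩Wᵢ⊆Iᵢ (Cⱼ⊆I x∈Cⱼ) x∈Wᵢ) here)
        where F-walk = proj₂ (proj₂ (proj₂ F-tour)) j x y x∈Cⱼ y∈Cⱼ

  Iᵢ-joined : ∀ {i x y} → x ∈ I (Φs i) → y ∈ I (Φs i) → ContractedReach (I Φ) F′ x y
  Iᵢ-joined {i} {x} {y} x∈Iᵢ y∈Iᵢ = anchored-interface y-anchored y∈Iᵢ
    where
      open Anchoring (ContractedReach (I Φ) F′ x)
                     (λ Px a⇝b → Reach-trans Px (Reach⇒ContractedReach a⇝b))
      y-anchored : Anchored y
      y-anchored = proj₁ (ContractedReach⇒ (⟺-on-isEquivalence Anchored) anchored-edge
                            (anchored-glue (λ a∈I b∈I Px → Reach-trans Px (ContractedReach-∈ a∈I b∈I)))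
                            (F-connected x y ∈⊤ ∈⊤))
                         (anchored x∈Iᵢ here)

  F-edges-joined : ∀ {a b} → (a , b) ∈ᴸ F → ContractedReach (I Φ) F′ a b
  F-edges-joined {a} {b} ab∈F with i , a∈Wᵢ ← W-cover a | j , b∈Wⱼ ← W-cover b | i ≟ j
  ... | yes refl = ContractedReach⇒ (ContractedReach-isEquivalence (I Φ) F′)
                     (λ e → Reach⇒ContractedReach (fwd (Fᵢ⊆F′ e) here)) Iᵢ-joined
                     (proj₁ (proj₂ (proj₂ (Fs-tour i))) a b a∈Wᵢ b∈Wⱼ)
  ... | no i≢j = Reach⇒ContractedReach (fwd (crossing⊆F′ ab∈F (crosses-∈∉ W i a∈Wᵢ b∉Wᵢ)) here)
    where
      b∉Wᵢ : b ∉ W i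
      b∉Wᵢ b∈Wᵢ = i≢j (W-disjoint i j b b∈Wᵢ b∈Wⱼ)

  F′-connected : ContractedConnected ⊤ (I Φ) F′
  F′-connected u v _ _ = ContractedReach⇒ (ContractedReach-isEquivalence (I Φ) F′) F-edges-joined
                           ContractedReach-∈ (F-connected u v ∈⊤ ∈⊤)

  F′-tour : IsTour G ⊤ Φ F′
  F′-tour = F′-edges , F′-odd , F′-connected , F′-blocks

lemma5p7 : ∀ {n} (G : WGraph n) (Φ : Interface n) (F : EdgeMS n)
           → IsInterfaceOf ⊤ Φ
           → IsTour G ⊤ Φ F
           → (p : ℕ) (W : Fin (suc p) → Subset n)
           → IsPartition ⊤ (suc p) W
           → (Φs : Fin (suc p) → Interface n)
           → (∀ i → IsInducedInterface F Φ (W i) (Φs i))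
           → (Fs : Fin (suc p) → EdgeMS n)
           → (∀ i → IsTour G (W i) (Φs i) (Fs i))
           → IsTour G ⊤ Φ (recombine W F Fs)
lemma5p7 G Φ F Φ-interface F-tour p W W-partition Φs Φs-induced Fs Fs-tour =
  Recombination.F′-tour G Φ F Φ-interface F-tour W W-partition Φs Φs-induced Fs Fs-tour
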